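{- If a 2-connected graph $G$ has two odd circuits having at most one common vertex, then $G$ contains an odd-$C_3^+$.
   Context: Graphs are finite, may have parallel edges but no loops; $G$ contains $H$ if $H$ is a subgraph. A circuit is a connected 2-regular graph, odd if it has an odd number of edges. A totally odd subdivision of a graph $H$ replaces each edge $e$ by a path with an odd number of edges joining the ends of $e$, paths for distinct edges sharing no inner vertices. $C_3^+$ is the triangle $K_3$ with one edge doubled by a parallel edge; an odd-$C_3^+$ is a totally odd subdivision of $C_3^+$. -}

module Defs where

open import Data.Nat using (ℕ; zero; suc; _+_; _*_; _≤_)
open import Data.Fin using (Fin; zero; suc; toℕ; fromℕ; inject₁)
open import Data.Product using (Σ; _×_; _,_; proj₁; proj₂)
open import Data.Sum using (_⊎_)
open import Relation.Binary.PropositionalEquality using (_≡_; _≢_)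
open import Relation.Nullary using (¬_)

record Graph : Set where
  field
    n     : ℕ
    m     : ℕ
    ends  : Fin m → Fin n × Fin n
    loopless : ∀ e → proj₁ (ends e) ≢ proj₂ (ends e)

open Graph public

V : Graph → Set
V G = Fin (n G)

E : Graph → Set
E G = Fin (m G)

Joins : (G : Graph) → E G → V G → V G → Set
Joins G e x y = ends G e ≡ (x , y) ⊎ ends G e ≡ (y , x)

Odd : ℕ → Set
Odd k = Σ ℕ λ j → k ≡ suc (2 * j)

record Path (G : Graph) (u w : V G) : Set where
  field
    len   : ℕ
    vert  : Fin (suc len) → V G
    edge  : Fin len → E G
    start : vert zero ≡ u
    end   : vert (fromℕ len) ≡ w
    joins : ∀ i → Joins G (edge i) (vert (inject₁ i)) (vert (suc i))
    vinj  : ∀ i j → vert i ≡ vert j → i ≡ j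

open Path public

Internal : ∀ {G u w} → (P : Path G u w) → Fin (suc (len P)) → Set
Internal P i = toℕ i ≢ 0 × toℕ i ≢ len P

-- A circuit (connected 2-regular subgraph) of G: a cyclic sequence of
-- len = suc k ≥ 2 distinct vertices and len distinct edges, edge i joining
-- vertex i and vertex i+1 (mod len).
record Circuit (G : Graph) : Set where
  field
    k      : ℕ
    k≥1    : 1 ≤ k
    cvert  : Fin (suc k) → V G
    cedge  : Fin (suc k) → E G
    cjoins : ∀ (i : Fin k) → Joins G (cedge (inject₁ i)) (cvert (inject₁ i)) (cvert (suc i))
    cjoinsLast : Joins G (cedge (fromℕ k)) (cvert (fromℕ k)) (cvert zero)
    cvinj  : ∀ i j → cvert i ≡ cvert j → i ≡ j
    ceinj  : ∀ i j → cedge i ≡ cedge j → i ≡ j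

open Circuit public

clen : ∀ {G} → Circuit G → ℕ
clen C = suc (k C)

OddCircuit : ∀ {G} → Circuit G → Set
OddCircuit C = Odd (clen C)

AtMostOneCommonVertex : ∀ {G} → Circuit G → Circuit G → Set
AtMostOneCommonVertex C D =
  ∀ i j i' j' → cvert C i ≡ cvert D j → cvert C i' ≡ cvert D j' → cvert C i ≡ cvert C i'

ConnectedAvoiding : (G : Graph) → V G → Set
ConnectedAvoiding G v =
  ∀ (x y : V G) → x ≢ v → y ≢ v →
    Σ (Path G x y) λ P → ∀ i → vert P i ≢ v

Connected : Graph → Set
Connected G = ∀ (x y : V G) → Path G x y

TwoConnected : Graph → Set
TwoConnected G = (3 ≤ n G) × Connected G × (∀ v → ConnectedAvoiding G v)

InternallyDisjoint : ∀ {G a b c d} → Path G a b → Path G c d → Set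
InternallyDisjoint P Q =
  (∀ i j → Internal P i → vert P i ≢ vert Q j) ×
  (∀ i j → Internal Q j → vert P i ≢ vert Q j) ×
  (∀ i j → edge P i ≢ edge Q j)

-- G contains an odd-C₃⁺: a totally odd subdivision of the triangle abc with
-- the edge ab doubled, i.e. branch vertices a b c and four pairwise internally
-- disjoint odd paths a–b, a–b, b–c, c–a in G.
record OddC3+ (G : Graph) : Set where
  field
    a b c : V G
    a≢b : a ≢ b
    b≢c : b ≢ c
    c≢a : c ≢ a
    P₁ : Path G a b
    P₂ : Path G a b
    P₃ : Path G b c
    P₄ : Path G c a
    odd₁ : Odd (len P₁)
    odd₂ : Odd (len P₂)
    odd₃ : Odd (len P₃)
    odd₄ : Odd (len P₄)
    d₁₂ : InternallyDisjoint P₁ P₂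
    d₁₃ : InternallyDisjoint P₁ P₃
    d₁₄ : InternallyDisjoint P₁ P₄
    d₂₃ : InternallyDisjoint P₂ P₃
    d₂₄ : InternallyDisjoint P₂ P₄
    d₃₄ : InternallyDisjoint P₃ P₄

-- Represent the odd circuits as odd cycles C and D and join them by a bridge: a path P from
-- c₁ ∈ C to d₁ ∈ D meeting C and D only in its ends (trivial if C and D share a vertex).
-- Since c₁ is not a cut vertex, a path Q avoiding c₁ runs from C − c₁ to D ∪ P and meets C
-- and D ∪ P only in its ends c₂ and x. If x ∈ D, then P, the arc of D from d₁ to x of the
-- right parity and Q form an odd c₁–c₂ path; with the odd and the even arc of C between c₁
-- and c₂ it makes a theta graph with two odd paths, and splitting its even path after the
-- first edge gives an odd-C₃⁺. If x ∈ P, then Q, an arc of C of the right parity and the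
-- segment of P from c₁ to x form a new odd cycle, bridged to D by the rest of P, which is
-- strictly shorter; induction on the length of the bridge finishes the proof.

module Submission where

open import Defs
open import Data.Empty using (⊥; ⊥-elim)
open import Data.Fin using (Fin; zero; suc; toℕ; fromℕ; inject₁; _≟_)
open import Data.Fin.Properties using (toℕ-fromℕ; toℕ-inject₁; fromℕ≢inject₁; suc-injective)
open import Data.List using (List; []; _∷_; _++_; [_])
open import Data.List.Membership.Propositional using (_∈_; _∉_; find; lose)
open import Data.List.Membership.Propositional.Properties using (∈-++⁺ˡ; ∈-++⁺ʳ; ∈-++⁻)
open import Data.List.Relation.Binary.Disjoint.Propositional using (Disjoint)
open import Data.List.Relation.Binary.Subset.Propositional using (_⊆_)
open import Data.List.Relation.Unary.All using ([]; _∷_)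
open import Data.List.Relation.Unary.All.Properties using (All¬⇒¬Any; ¬Any⇒All¬; anti-mono)
  renaming (++⁻ˡ to All-++⁻ˡ)
open import Data.List.Relation.Unary.Any using (here; there; any?)
open import Data.List.Relation.Unary.Unique.Propositional using (Unique; []; _∷_)
open import Data.List.Relation.Unary.Unique.Propositional.Properties using (++⁺)
open import Data.Nat using (ℕ; zero; suc; _+_; _*_; _≤_; _<_; s≤s; z≤n; parity)
open import Data.Nat.Induction using (<-rec)
open import Data.Nat.Properties using (+-comm; +-assoc; *-suc; n≮n; m≤n+m; +-mono-≤; +-monoˡ-≤; ≤-trans)
open import Data.Parity.Base using (0ℙ; 1ℙ; _⁻¹) renaming (_+_ to _⊕_)
open import Data.Parity.Properties using (+-homo-+; *-homo-*; suc-homo-⁻¹) renaming (+-identityʳ to ⊕-identityʳ)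
open import Algebra.Properties.CommutativeSemigroup Data.Parity.Properties.+-commutativeSemigroup
  using (xy∙z≈y∙xz)
open import Data.Product using (Σ; ∃; _×_; _,_; proj₁; proj₂)
open import Data.Sum using (_⊎_; inj₁; inj₂; [_,_]′)
open import Relation.Binary.PropositionalEquality
  using (_≡_; _≢_; refl; sym; trans; cong; subst; module ≡-Reasoning)
open import Relation.Nullary using (¬_; Dec; yes; no)
open import Relation.Nullary.Decidable using (_×-dec_; _⊎-dec_; ¬?)

module _ {A : Set} where

  Unique-head∉ : ∀ {x : A} {xs} → Unique (x ∷ xs) → x ∉ xs
  Unique-head∉ (x≢xs ∷ _) = All¬⇒¬Any x≢xs

  Unique-++⁻ˡ : ∀ (xs : List A) {ys} → Unique (xs ++ ys) → Unique xs
  Unique-++⁻ˡ []       _        = []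
  Unique-++⁻ˡ (x ∷ xs) (x≢ ∷ u) = All-++⁻ˡ xs x≢ ∷ Unique-++⁻ˡ xs u

  Unique-++⁻ʳ : ∀ (xs : List A) {ys} → Unique (xs ++ ys) → Unique ys
  Unique-++⁻ʳ []       u       = u
  Unique-++⁻ʳ (x ∷ xs) (_ ∷ u) = Unique-++⁻ʳ xs u

  Unique-++⇒Disjoint : ∀ (xs : List A) {ys} → Unique (xs ++ ys) → Disjoint xs ys
  Unique-++⇒Disjoint (x ∷ xs) u (here refl , v∈ys) = Unique-head∉ u (∈-++⁺ʳ xs v∈ys)
  Unique-++⇒Disjoint (x ∷ xs) (_ ∷ u) (there v∈xs , v∈ys) = Unique-++⇒Disjoint xs u (v∈xs , v∈ys)

  Unique-++-comm : ∀ (xs : List A) {ys} → Unique (xs ++ ys) → Unique (ys ++ xs)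
  Unique-++-comm xs u =
    ++⁺ (Unique-++⁻ʳ xs u) (Unique-++⁻ˡ xs u) (λ (v∈ys , v∈xs) → Unique-++⇒Disjoint xs u (v∈xs , v∈ys))

Odd⇒parity : ∀ {n} → Odd n → parity n ≡ 1ℙ
Odd⇒parity (j , refl) = trans (+-homo-+ 1 (2 * j)) (cong (1ℙ ⊕_) (*-homo-* 2 j))

parity⇒Odd : ∀ n → parity n ≡ 1ℙ → Odd n
parity⇒Odd 1 _ = 0 , refl
parity⇒Odd (suc (suc n)) p with parity⇒Odd n p
... | j , refl = suc j , cong suc (sym (*-suc 2 j))

parity≡1ℙ⇒≥1 : ∀ {n} → parity n ≡ 1ℙ → 1 ≤ n
parity≡1ℙ⇒≥1 {suc _} _ = s≤s z≤n

opposite-parities : ∀ p q r → p ⊕ q ≡ 1ℙ → (p ⊕ r ≡ 1ℙ × q ⊕ r ≡ 0ℙ) ⊎ (q ⊕ r ≡ 1ℙ × p ⊕ r ≡ 0ℙ)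
opposite-parities 0ℙ 1ℙ 0ℙ _ = inj₂ (refl , refl)
opposite-parities 0ℙ 1ℙ 1ℙ _ = inj₁ (refl , refl)
opposite-parities 1ℙ 0ℙ 0ℙ _ = inj₁ (refl , refl)
opposite-parities 1ℙ 0ℙ 1ℙ _ = inj₂ (refl , refl)

parity-rearrange : ∀ m n k → parity (m + n + k) ≡ parity n ⊕ parity (m + k)
parity-rearrange m n k = begin
  parity (m + n + k)                 ≡⟨ +-homo-+ (m + n) k ⟩
  parity (m + n) ⊕ parity k          ≡⟨ cong (_⊕ parity k) (+-homo-+ m n) ⟩
  parity m ⊕ parity n ⊕ parity k     ≡⟨ xy∙z≈y∙xz (parity m) (parity n) (parity k) ⟩
  parity n ⊕ (parity m ⊕ parity k)   ≡⟨ cong (parity n ⊕_) (sym (+-homo-+ m k)) ⟩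
  parity n ⊕ parity (m + k)          ∎
  where open ≡-Reasoning

module Walks (G : Graph) where

  data Walk : V G → V G → Set where
    nil  : (u : V G) → Walk u u
    cons : ∀ {u v w} (e : E G) → Joins G e u v → Walk v w → Walk u w

  vertices : ∀ {a b} → Walk a b → List (V G)
  vertices (nil u)          = [ u ]
  vertices (cons {u} _ _ p) = u ∷ vertices p

  -- For a closed walk: its vertices, with the base counted once.
  initVertices : ∀ {a b} → Walk a b → List (V G)
  initVertices (nil _)          = []
  initVertices (cons {u} _ _ p) = u ∷ initVertices p

  length : ∀ {a b} → Walk a b → ℕ
  length (nil _)      = 0
  length (cons _ _ p) = suc (length p)

  infixr 5 _++ʷ_
  _++ʷ_ : ∀ {a b c} → Walk a b → Walk b c → Walk a c
  nil _      ++ʷ q = q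
  cons e j p ++ʷ q = cons e j (p ++ʷ q)

  Joins-sym : ∀ {e x y} → Joins G e x y → Joins G e y x
  Joins-sym (inj₁ p) = inj₂ p
  Joins-sym (inj₂ p) = inj₁ p

  reverse : ∀ {a b} → Walk a b → Walk b a
  reverse (nil u)          = nil u
  reverse (cons {u} e j p) = reverse p ++ʷ cons e (Joins-sym j) (nil u)

  IsPath : ∀ {a b} → Walk a b → Set
  IsPath p = Unique (vertices p)

  IsCycle : ∀ {a} → Walk a a → Set
  IsCycle p = Unique (initVertices p)

  Endpoint : V G → V G → V G → Set
  Endpoint s t y = y ≡ s ⊎ y ≡ t

  MeetWithin : ∀ {a b c d} → Walk a b → Walk c d → V G → V G → Set
  MeetWithin p q s t = ∀ {y} → y ∈ vertices p → y ∈ vertices q → Endpoint s t y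

  vertices-++ʷ : ∀ {a b c} (p : Walk a b) (q : Walk b c) → vertices (p ++ʷ q) ≡ initVertices p ++ vertices q
  vertices-++ʷ (nil _)      q = refl
  vertices-++ʷ (cons _ _ p) q = cong (_ ∷_) (vertices-++ʷ p q)

  initVertices-++ʷ : ∀ {a b c} (p : Walk a b) (q : Walk b c) →
                     initVertices (p ++ʷ q) ≡ initVertices p ++ initVertices q
  initVertices-++ʷ (nil _)      q = refl
  initVertices-++ʷ (cons _ _ p) q = cong (_ ∷_) (initVertices-++ʷ p q)

  vertices≡initVertices∷ʳ : ∀ {a b} (p : Walk a b) → vertices p ≡ initVertices p ++ [ b ]
  vertices≡initVertices∷ʳ (nil _)      = refl
  vertices≡initVertices∷ʳ (cons _ _ p) = cong (_ ∷_) (vertices≡initVertices∷ʳ p)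

  length-++ʷ : ∀ {a b c} (p : Walk a b) (q : Walk b c) → length (p ++ʷ q) ≡ length p + length q
  length-++ʷ (nil _)      q = refl
  length-++ʷ (cons _ _ p) q = cong suc (length-++ʷ p q)

  length-reverse : ∀ {a b} (p : Walk a b) → length (reverse p) ≡ length p
  length-reverse (nil _)      = refl
  length-reverse (cons e j p) = begin
    length (reverse p ++ʷ cons e (Joins-sym j) (nil _)) ≡⟨ length-++ʷ (reverse p) _ ⟩
    length (reverse p) + 1                              ≡⟨ cong (_+ 1) (length-reverse p) ⟩
    length p + 1                                        ≡⟨ +-comm (length p) 1 ⟩
    suc (length p)                                      ∎
    where open ≡-Reasoning

  length≥1 : ∀ {a b} (p : Walk a b) → a ≢ b → 1 ≤ length p
  length≥1 (nil _)      a≢a = ⊥-elim (a≢a refl)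
  length≥1 (cons _ _ _) _   = s≤s z≤n

  start∈vertices : ∀ {a b} (p : Walk a b) → a ∈ vertices p
  start∈vertices (nil _)      = here refl
  start∈vertices (cons _ _ _) = here refl

  end∈vertices : ∀ {a b} (p : Walk a b) → b ∈ vertices p
  end∈vertices (nil _)      = here refl
  end∈vertices (cons _ _ p) = there (end∈vertices p)

  start∈initVertices : ∀ {a b} (p : Walk a b) → a ≢ b → a ∈ initVertices p
  start∈initVertices (nil _)      a≢a = ⊥-elim (a≢a refl)
  start∈initVertices (cons _ _ _) _   = here refl

  initVertices⊆vertices : ∀ {a b} (p : Walk a b) {y} → y ∈ initVertices p → y ∈ vertices p
  initVertices⊆vertices (cons _ _ p) (here r)  = here r
  initVertices⊆vertices (cons _ _ p) (there m) = there (initVertices⊆vertices p m)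

  ∈vertices⇒∈initVertices⊎end : ∀ {a b} (p : Walk a b) {y} → y ∈ vertices p → y ∈ initVertices p ⊎ y ≡ b
  ∈vertices⇒∈initVertices⊎end (nil _)      (here r)  = inj₂ r
  ∈vertices⇒∈initVertices⊎end (cons _ _ p) (here r)  = inj₁ (here r)
  ∈vertices⇒∈initVertices⊎end (cons _ _ p) (there m) with ∈vertices⇒∈initVertices⊎end p m
  ... | inj₁ y∈ = inj₁ (there y∈)
  ... | inj₂ y≡b = inj₂ y≡b

  ∈-++ʷ⁻ : ∀ {a b c} (p : Walk a b) (q : Walk b c) {y} →
           y ∈ vertices (p ++ʷ q) → y ∈ vertices p ⊎ y ∈ vertices q
  ∈-++ʷ⁻ p q m rewrite vertices-++ʷ p q with ∈-++⁻ (initVertices p) m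
  ... | inj₁ y∈p = inj₁ (initVertices⊆vertices p y∈p)
  ... | inj₂ y∈q = inj₂ y∈q

  ∈-++ʷ⁺ˡ : ∀ {a b c} (p : Walk a b) (q : Walk b c) {y} → y ∈ vertices p → y ∈ vertices (p ++ʷ q)
  ∈-++ʷ⁺ˡ p q m rewrite vertices-++ʷ p q with ∈vertices⇒∈initVertices⊎end p m
  ... | inj₁ y∈ = ∈-++⁺ˡ y∈
  ... | inj₂ refl = ∈-++⁺ʳ (initVertices p) (start∈vertices q)

  ∈-++ʷ⁺ʳ : ∀ {a b c} (p : Walk a b) (q : Walk b c) {y} → y ∈ vertices q → y ∈ vertices (p ++ʷ q)
  ∈-++ʷ⁺ʳ p q m rewrite vertices-++ʷ p q = ∈-++⁺ʳ (initVertices p) m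

  ∈-reverse⁻ : ∀ {a b} (p : Walk a b) {y} → y ∈ vertices (reverse p) → y ∈ vertices p
  ∈-reverse⁻ (nil _)      m = m
  ∈-reverse⁻ (cons e j p) m with ∈-++ʷ⁻ (reverse p) _ m
  ... | inj₁ y∈ = there (∈-reverse⁻ p y∈)
  ... | inj₂ (here refl) = there (start∈vertices p)
  ... | inj₂ (there (here refl)) = here refl

  split : ∀ {a b} (p : Walk a b) {y} → y ∈ vertices p →
          Σ (Walk a y) λ p₁ → Σ (Walk y b) λ p₂ → p ≡ p₁ ++ʷ p₂
  split (nil _)      (here refl) = nil _ , nil _ , refl
  split (cons e j p) (here refl) = nil _ , cons e j p , refl
  split (cons e j p) (there m) with split p m
  ... | p₁ , p₂ , refl = cons e j p₁ , p₂ , refl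

  IsPath⇒Unique-initVertices : ∀ {a b} (p : Walk a b) → IsPath p → Unique (initVertices p)
  IsPath⇒Unique-initVertices p u rewrite vertices≡initVertices∷ʳ p = Unique-++⁻ˡ (initVertices p) u

  IsPath⇒end∉initVertices : ∀ {a b} (p : Walk a b) → IsPath p → b ∉ initVertices p
  IsPath⇒end∉initVertices p u b∈ rewrite vertices≡initVertices∷ʳ p =
    Unique-++⇒Disjoint (initVertices p) u (b∈ , here refl)

  IsPath-++ʷ : ∀ {a b c} (p : Walk a b) (q : Walk b c) → IsPath p → IsPath q →
               (∀ {y} → y ∈ vertices p → y ∈ vertices q → y ≡ b) → IsPath (p ++ʷ q)
  IsPath-++ʷ p q up uq meet rewrite vertices-++ʷ p q =
    ++⁺ (IsPath⇒Unique-initVertices p up) uq λ (y∈p , y∈q) →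
      IsPath⇒end∉initVertices p up (subst (_∈ initVertices p) (meet (initVertices⊆vertices p y∈p) y∈q) y∈p)

  IsPath-++ʷ⁻ : ∀ {a b c} (p : Walk a b) (q : Walk b c) → IsPath (p ++ʷ q) →
                IsPath p × IsPath q × (∀ {y} → y ∈ vertices p → y ∈ vertices q → y ≡ b)
  IsPath-++ʷ⁻ {b = b} p q u rewrite vertices-++ʷ p q = up , Unique-++⁻ʳ (initVertices p) u , meet
    where
    disjoint : Disjoint (initVertices p) (vertices q)
    disjoint = Unique-++⇒Disjoint (initVertices p) u
    up : IsPath p
    up rewrite vertices≡initVertices∷ʳ p =
      ++⁺ (Unique-++⁻ˡ (initVertices p) u) ([] ∷ []) λ { (y∈ , here refl) → disjoint (y∈ , start∈vertices q) }
    meet : ∀ {y} → y ∈ vertices p → y ∈ vertices q → y ≡ b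
    meet y∈p y∈q with ∈vertices⇒∈initVertices⊎end p y∈p
    ... | inj₁ y∈ = ⊥-elim (disjoint (y∈ , y∈q))
    ... | inj₂ y≡b = y≡b

  IsPath⇒start≢end : ∀ {a b} (p : Walk a b) → IsPath p → 1 ≤ length p → a ≢ b
  IsPath⇒start≢end (cons _ _ p) (a≢p ∷ _) _ refl = All¬⇒¬Any a≢p (end∈vertices p)

  IsPath-reverse : ∀ {a b} (p : Walk a b) → IsPath p → IsPath (reverse p)
  IsPath-reverse (nil _)          u = u
  IsPath-reverse (cons {u} {v} e j p) (u≢p ∷ up) = IsPath-++ʷ (reverse p) vu (IsPath-reverse p up) vu-path meet
    where
    vu : Walk v u
    vu = cons e (Joins-sym j) (nil u)
    u∉p : u ∉ vertices p
    u∉p = All¬⇒¬Any u≢p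
    vu-path : IsPath vu
    vu-path = ((λ v≡u → u∉p (subst (_∈ vertices p) v≡u (start∈vertices p))) ∷ []) ∷ [] ∷ []
    meet : ∀ {y} → y ∈ vertices (reverse p) → y ∈ vertices vu → y ≡ v
    meet y∈ (here refl)         = refl
    meet y∈ (there (here refl)) = ⊥-elim (u∉p (∈-reverse⁻ p y∈))

  IsCycle-++ʷ : ∀ {a b} (p : Walk a b) (q : Walk b a) → IsPath p → IsPath q →
                MeetWithin p q a b → IsCycle (p ++ʷ q)
  IsCycle-++ʷ {a} {b} p q up uq meet rewrite initVertices-++ʷ p q =
    ++⁺ (IsPath⇒Unique-initVertices p up) (IsPath⇒Unique-initVertices q uq) λ where
      (y∈p , y∈q) → refute (meet (initVertices⊆vertices p y∈p) (initVertices⊆vertices q y∈q)) y∈p y∈q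
    where
    refute : ∀ {y} → Endpoint a b y → y ∈ initVertices p → y ∈ initVertices q → ⊥
    refute (inj₁ refl) _   y∈q = IsPath⇒end∉initVertices q uq y∈q
    refute (inj₂ refl) y∈p _   = IsPath⇒end∉initVertices p up y∈p

  IsCycle-++ʷ⁻ : ∀ {a b} (p : Walk a b) (q : Walk b a) → a ≢ b → IsCycle (p ++ʷ q) →
                 IsPath p × IsPath q × MeetWithin p q a b
  IsCycle-++ʷ⁻ {a} {b} p q a≢b u rewrite initVertices-++ʷ p q = up , uq , meet
    where
    disjoint : Disjoint (initVertices p) (initVertices q)
    disjoint = Unique-++⇒Disjoint (initVertices p) u
    up : IsPath p
    up rewrite vertices≡initVertices∷ʳ p =
      ++⁺ (Unique-++⁻ˡ (initVertices p) u) ([] ∷ [])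
        λ { (y∈ , here refl) → disjoint (y∈ , start∈initVertices q (λ b≡a → a≢b (sym b≡a))) }
    uq : IsPath q
    uq rewrite vertices≡initVertices∷ʳ q =
      ++⁺ (Unique-++⁻ʳ (initVertices p) u) ([] ∷ [])
        λ { (y∈ , here refl) → disjoint (start∈initVertices p a≢b , y∈) }
    meet : MeetWithin p q a b
    meet y∈p y∈q with ∈vertices⇒∈initVertices⊎end p y∈p | ∈vertices⇒∈initVertices⊎end q y∈q
    ... | inj₁ y∈p′ | inj₁ y∈q′ = ⊥-elim (disjoint (y∈p′ , y∈q′))
    ... | inj₁ _    | inj₂ y≡a  = inj₁ y≡a
    ... | inj₂ y≡b  | _         = inj₂ y≡b

  record Rotation {z} (Z : Walk z z) (x : V G) : Set where
    field
      rotated   : Walk x x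
      isCycle   : IsCycle rotated
      ⊆original : ∀ {y} → y ∈ initVertices rotated → y ∈ initVertices Z
      ⊇original : ∀ {y} → y ∈ initVertices Z → y ∈ initVertices rotated
      length≡   : length rotated ≡ length Z

  rotate : ∀ {z x} (Z : Walk z z) → IsCycle Z → x ∈ initVertices Z → Rotation Z x
  rotate Z u x∈ with split Z (initVertices⊆vertices Z x∈)
  ... | Z₁ , Z₂ , refl = record
    { rotated   = Z₂ ++ʷ Z₁
    ; isCycle   = subst Unique (sym (initVertices-++ʷ Z₂ Z₁))
                    (Unique-++-comm (initVertices Z₁) (subst Unique (initVertices-++ʷ Z₁ Z₂) u))
    ; ⊆original = λ y∈ → subst (_ ∈_) (sym (initVertices-++ʷ Z₁ Z₂))
                    (swap (initVertices Z₂) (subst (_ ∈_) (initVertices-++ʷ Z₂ Z₁) y∈))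
    ; ⊇original = λ y∈ → subst (_ ∈_) (sym (initVertices-++ʷ Z₂ Z₁))
                    (swap (initVertices Z₁) (subst (_ ∈_) (initVertices-++ʷ Z₁ Z₂) y∈))
    ; length≡   = trans (length-++ʷ Z₂ Z₁) (trans (+-comm (length Z₂) (length Z₁)) (sym (length-++ʷ Z₁ Z₂)))
    }
    where
    swap : ∀ xs {ys} {y : V G} → y ∈ xs ++ ys → y ∈ ys ++ xs
    swap xs {ys} y∈ = [ ∈-++⁺ʳ ys , ∈-++⁺ˡ ]′ (∈-++⁻ xs y∈)

  record STPath (S T : V G → Set) {s t} (p : Walk s t) : Set where
    field
      from to   : V G
      segment   : Walk from to
      isPath    : IsPath segment
      from∈S    : S from
      to∈T      : T to
      ⊆p        : vertices segment ⊆ vertices p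
      meetsS    : ∀ {y} → y ∈ vertices segment → S y → y ≡ from
      meetsT    : ∀ {y} → y ∈ vertices segment → T y → y ≡ to

  module _ {S T : V G → Set} (S? : ∀ y → Dec (S y)) (T? : ∀ y → Dec (T y)) where

    private
      PrefixTo : ∀ {s t} → Walk s t → Set
      PrefixTo {s} p = Σ (V G) λ d → Σ (Walk s d) λ q → IsPath q × T d × vertices q ⊆ vertices p ×
                         (∀ {y} → y ∈ vertices q → T y → y ≡ d)

      SuffixFrom : ∀ {s d} → Walk s d → Set
      SuffixFrom {d = d} p = Σ (V G) λ c → Σ (Walk c d) λ q → IsPath q × S c × vertices q ⊆ vertices p ×
                               (∀ {y} → y ∈ vertices q → S y → y ≡ c)

      prefixTo : ∀ {s t} (p : Walk s t) → IsPath p → T t → PrefixTo p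
      prefixTo (nil u) up t∈T = u , nil u , up , t∈T , (λ y∈ → y∈) , λ { (here r) _ → r }
      prefixTo (cons {u} e j p) (u≢p ∷ up) t∈T with T? u
      ... | yes u∈T = u , nil u , [] ∷ [] , u∈T , (λ { (here r) → here r }) , λ { (here r) _ → r }
      ... | no  u∉T with prefixTo p up t∈T
      ... | d , q , q-path , d∈T , q⊆p , meetsT =
        d , cons e j q , anti-mono q⊆p u≢p ∷ q-path , d∈T ,
        (λ { (here r) → here r ; (there y∈) → there (q⊆p y∈) }) ,
        λ { (here refl) u∈T → ⊥-elim (u∉T u∈T) ; (there y∈) y∈T → meetsT y∈ y∈T }

      suffixFrom : ∀ {s d} (p : Walk s d) → IsPath p → SuffixFrom p ⊎ (∀ {y} → y ∈ vertices p → ¬ S y)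
      suffixFrom (nil u) up with S? u
      ... | yes u∈S = inj₁ (u , nil u , up , u∈S , (λ y∈ → y∈) , λ { (here r) _ → r })
      ... | no  u∉S = inj₂ λ { (here refl) → u∉S }
      suffixFrom (cons {u} e j p) (u≢p ∷ up) with suffixFrom p up
      ... | inj₁ (c , q , q-path , c∈S , q⊆p , meetsS) =
        inj₁ (c , q , q-path , c∈S , (λ y∈ → there (q⊆p y∈)) , meetsS)
      ... | inj₂ p∩S=∅ with S? u
      ... | yes u∈S = inj₁ (u , cons e j p , u≢p ∷ up , u∈S , (λ y∈ → y∈) ,
                        λ { (here r) _ → r ; (there y∈) y∈S → ⊥-elim (p∩S=∅ y∈ y∈S) })
      ... | no  u∉S = inj₂ λ { (here refl) → u∉S ; (there y∈) → p∩S=∅ y∈ }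

    -- Cut p at its first vertex in T, then at the last vertex in S before it.
    stPath : ∀ {s t} (p : Walk s t) → IsPath p → S s → T t → STPath S T p
    stPath p up s∈S t∈T with prefixTo p up t∈T
    ... | d , q , q-path , d∈T , q⊆p , meetsT with suffixFrom q q-path
    ... | inj₂ q∩S=∅ = ⊥-elim (q∩S=∅ (start∈vertices q) s∈S)
    ... | inj₁ (c , r , r-path , c∈S , r⊆q , meetsS) = record
      { from = c ; to = d ; segment = r ; isPath = r-path ; from∈S = c∈S ; to∈T = d∈T
      ; ⊆p = λ y∈ → q⊆p (r⊆q y∈) ; meetsS = meetsS ; meetsT = λ y∈ y∈T → meetsT (r⊆q y∈) y∈T }

module WalksAsPaths (G : Graph) where
  open Walks G

  vertexAt : ∀ {a b} (p : Walk a b) → Fin (suc (length p)) → V G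
  vertexAt (nil u)          zero    = u
  vertexAt (cons {u} _ _ _) zero    = u
  vertexAt (cons _ _ p)     (suc i) = vertexAt p i

  edgeAt : ∀ {a b} (p : Walk a b) → Fin (length p) → E G
  edgeAt (cons e _ _) zero    = e
  edgeAt (cons _ _ p) (suc i) = edgeAt p i

  vertexAt-start : ∀ {a b} (p : Walk a b) → vertexAt p zero ≡ a
  vertexAt-start (nil _)      = refl
  vertexAt-start (cons _ _ _) = refl

  vertexAt-end : ∀ {a b} (p : Walk a b) → vertexAt p (fromℕ (length p)) ≡ b
  vertexAt-end (nil _)      = refl
  vertexAt-end (cons _ _ p) = vertexAt-end p

  edgeAt-joins : ∀ {a b} (p : Walk a b) (i : Fin (length p)) →
                 Joins G (edgeAt p i) (vertexAt p (inject₁ i)) (vertexAt p (suc i))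
  edgeAt-joins (cons {u} e j p) zero    = subst (Joins G e u) (sym (vertexAt-start p)) j
  edgeAt-joins (cons _ _ p)     (suc i) = edgeAt-joins p i

  vertexAt∈vertices : ∀ {a b} (p : Walk a b) i → vertexAt p i ∈ vertices p
  vertexAt∈vertices (nil _)      zero    = here refl
  vertexAt∈vertices (cons _ _ _) zero    = here refl
  vertexAt∈vertices (cons _ _ p) (suc i) = there (vertexAt∈vertices p i)

  vertexAt-injective : ∀ {a b} (p : Walk a b) → IsPath p → ∀ i k → vertexAt p i ≡ vertexAt p k → i ≡ k
  vertexAt-injective (nil _)      _        zero    zero    _  = refl
  vertexAt-injective (cons _ _ _) _        zero    zero    _  = refl
  vertexAt-injective (cons _ _ p) (u≢ ∷ _) zero    (suc k) eq =
    ⊥-elim (All¬⇒¬Any u≢ (subst (_∈ vertices p) (sym eq) (vertexAt∈vertices p k)))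
  vertexAt-injective (cons _ _ p) (u≢ ∷ _) (suc i) zero    eq =
    ⊥-elim (All¬⇒¬Any u≢ (subst (_∈ vertices p) eq (vertexAt∈vertices p i)))
  vertexAt-injective (cons _ _ p) (_ ∷ up) (suc i) (suc k) eq = cong suc (vertexAt-injective p up i k eq)

  toPath : ∀ {a b} (p : Walk a b) → IsPath p → Path G a b
  toPath p up = record
    { len = length p ; vert = vertexAt p ; edge = edgeAt p
    ; start = vertexAt-start p ; end = vertexAt-end p
    ; joins = edgeAt-joins p ; vinj = vertexAt-injective p up }

  sequenceWalk : ∀ l (f : Fin (suc l) → V G) (g : Fin l → E G) →
                 (∀ i → Joins G (g i) (f (inject₁ i)) (f (suc i))) → Walk (f zero) (f (fromℕ l))
  sequenceWalk zero    f g j = nil (f zero)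
  sequenceWalk (suc l) f g j =
    cons (g zero) (j zero) (sequenceWalk l (λ i → f (suc i)) (λ i → g (suc i)) (λ i → j (suc i)))

  length-sequenceWalk : ∀ l f g j → length (sequenceWalk l f g j) ≡ l
  length-sequenceWalk zero    f g j = refl
  length-sequenceWalk (suc l) f g j = cong suc (length-sequenceWalk l _ _ _)

  ∈-sequenceWalk : ∀ l f g j {y} → y ∈ vertices (sequenceWalk l f g j) → ∃ λ i → f i ≡ y
  ∈-sequenceWalk zero    f g j (here refl) = zero , refl
  ∈-sequenceWalk (suc l) f g j (here refl) = zero , refl
  ∈-sequenceWalk (suc l) f g j (there y∈) with ∈-sequenceWalk l _ _ _ y∈
  ... | i , fi≡y = suc i , fi≡y

  IsPath-sequenceWalk : ∀ l f g j → (∀ i k → f i ≡ f k → i ≡ k) → IsPath (sequenceWalk l f g j)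
  IsPath-sequenceWalk zero    f g j f-inj = [] ∷ []
  IsPath-sequenceWalk (suc l) f g j f-inj =
    ¬Any⇒All¬ _ (λ f0∈ → head-fresh (∈-sequenceWalk l _ _ _ f0∈))
      ∷ IsPath-sequenceWalk l _ _ _ (λ i k eq → suc-injective (f-inj (suc i) (suc k) eq))
    where
    head-fresh : ¬ (∃ λ i → f (suc i) ≡ f zero)
    head-fresh (i , eq) with f-inj _ _ eq
    ... | ()

  retarget : ∀ {a b a′ b′} → a ≡ a′ → b ≡ b′ → Walk a b → Walk a′ b′
  retarget refl refl p = p

  vertices-retarget : ∀ {a b a′ b′} (e₁ : a ≡ a′) (e₂ : b ≡ b′) (p : Walk a b) →
                      vertices (retarget e₁ e₂ p) ≡ vertices p
  vertices-retarget refl refl p = refl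

  fromPath : ∀ {x y} (P : Path G x y) →
             Σ (Walk x y) λ w → IsPath w × (∀ {v} → v ∈ vertices w → ∃ λ i → vert P i ≡ v)
  fromPath P =
    retarget (start P) (end P) w , subst Unique (sym same) w-path , λ v∈ → w⊆P (subst (_ ∈_) same v∈)
    where
    w : Walk (vert P zero) (vert P (fromℕ (len P)))
    w = sequenceWalk (len P) (vert P) (edge P) (joins P)
    w-path : IsPath w
    w-path = IsPath-sequenceWalk (len P) (vert P) (edge P) (joins P) (vinj P)
    w⊆P : ∀ {v} → v ∈ vertices w → ∃ λ i → vert P i ≡ v
    w⊆P = ∈-sequenceWalk (len P) (vert P) (edge P) (joins P)
    same : vertices (retarget (start P) (end P) w) ≡ vertices w
    same = vertices-retarget (start P) (end P) w

  endpoint⇒¬Internal : ∀ {a b} (P : Path G a b) i → Endpoint a b (vert P i) → ¬ Internal P i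
  endpoint⇒¬Internal P i (inj₁ eq) (≢0 , _) = ≢0 (cong toℕ (vinj P i zero (trans eq (sym (start P)))))
  endpoint⇒¬Internal P i (inj₂ eq) (_ , ≢len) =
    ≢len (trans (cong toℕ (vinj P i (fromℕ (len P)) (trans eq (sym (end P))))) (toℕ-fromℕ _))

  edge-between-ends : ∀ {c d} (Q : Path G c d) (j : Fin (len Q)) →
                      Endpoint c d (vert Q (inject₁ j)) → Endpoint c d (vert Q (suc j)) →
                      len Q ≡ 1 × vert Q (inject₁ j) ≡ c × vert Q (suc j) ≡ d
  edge-between-ends Q j (inj₂ eq) _ =
    ⊥-elim (fromℕ≢inject₁ (sym (vinj Q _ (fromℕ (len Q)) (trans eq (sym (end Q))))))
  edge-between-ends Q j (inj₁ eq) (inj₁ eq′) with vinj Q (suc j) zero (trans eq′ (sym (start Q)))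
  ... | ()
  edge-between-ends Q j (inj₁ eq) (inj₂ eq′) = len≡1 , eq , eq′
    where
    j≡0 : inject₁ j ≡ zero
    j≡0 = vinj Q _ zero (trans eq (sym (start Q)))
    1+j≡len : suc j ≡ fromℕ (len Q)
    1+j≡len = vinj Q _ (fromℕ (len Q)) (trans eq′ (sym (end Q)))
    len≡1 : len Q ≡ 1
    len≡1 = begin
      len Q                    ≡⟨ sym (toℕ-fromℕ (len Q)) ⟩
      toℕ (fromℕ (len Q))      ≡⟨ cong toℕ (sym 1+j≡len) ⟩
      suc (toℕ j)              ≡⟨ cong suc (sym (toℕ-inject₁ j)) ⟩
      suc (toℕ (inject₁ j))    ≡⟨ cong (λ i → suc (toℕ i)) j≡0 ⟩
      1                        ∎
      where open ≡-Reasoning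

  Joins-ends : ∀ {e x y x′ y′} → Joins G e x y → Joins G e x′ y′ → (x ≡ x′ × y ≡ y′) ⊎ (x ≡ y′ × y ≡ x′)
  Joins-ends (inj₁ p) (inj₁ q) = inj₁ (cong proj₁ (trans (sym p) q) , cong proj₂ (trans (sym p) q))
  Joins-ends (inj₁ p) (inj₂ q) = inj₂ (cong proj₁ (trans (sym p) q) , cong proj₂ (trans (sym p) q))
  Joins-ends (inj₂ p) (inj₁ q) = inj₂ (cong proj₂ (trans (sym p) q) , cong proj₁ (trans (sym p) q))
  Joins-ends (inj₂ p) (inj₂ q) = inj₁ (cong proj₂ (trans (sym p) q) , cong proj₁ (trans (sym p) q))

  sharedEdge-ends : ∀ {a b c d} (P : Path G a b) (Q : Path G c d) i j → edge P i ≡ edge Q j →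
                    (∃ λ i′ → vert P i′ ≡ vert Q (inject₁ j)) × (∃ λ i′ → vert P i′ ≡ vert Q (suc j))
  sharedEdge-ends P Q i j eq with Joins-ends (joins P i) (subst (λ e → Joins G e _ _) (sym eq) (joins Q j))
  ... | inj₁ (e₁ , e₂) = (inject₁ i , e₁) , (suc i , e₂)
  ... | inj₂ (e₁ , e₂) = (suc i , e₂) , (inject₁ i , e₁)

  -- The last hypothesis rules out that P and Q are one and the same edge.
  internallyDisjoint : ∀ {a b c d} (P : Path G a b) (Q : Path G c d) →
    (∀ i j → vert P i ≡ vert Q j → Endpoint a b (vert P i) × Endpoint c d (vert Q j)) →
    2 ≤ len Q ⊎ (∃ λ z → Endpoint c d z × ¬ Endpoint a b z) → InternallyDisjoint P Q
  internallyDisjoint {a} {b} {c} {d} P Q common notSameEdge =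
    (λ i j int eq → endpoint⇒¬Internal P i (proj₁ (common i j eq)) int) ,
    (λ i j int eq → endpoint⇒¬Internal Q j (proj₂ (common i j eq)) int) ,
    noSharedEdge
    where
    noSharedEdge : ∀ i j → edge P i ≢ edge Q j
    noSharedEdge i j eq with sharedEdge-ends P Q i j eq
    ... | (i₁ , e₁) , (i₂ , e₂) with common i₁ _ e₁ | common i₂ _ e₂
    ... | ab₁ , cd₁ | ab₂ , cd₂ = refute notSameEdge (edge-between-ends Q j cd₁ cd₂)
      where
      refute : 2 ≤ len Q ⊎ (∃ λ z → Endpoint c d z × ¬ Endpoint a b z) →
               len Q ≡ 1 × vert Q (inject₁ j) ≡ c × vert Q (suc j) ≡ d → ⊥
      refute (inj₁ 2≤len) (len≡1 , _) = n≮n 1 (subst (2 ≤_) len≡1 2≤len)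
      refute (inj₂ (z , inj₁ refl , z∉ab)) (_ , q≡c , _) = z∉ab (subst (Endpoint a b) (trans e₁ q≡c) ab₁)
      refute (inj₂ (z , inj₂ refl , z∉ab)) (_ , _ , q≡d) = z∉ab (subst (Endpoint a b) (trans e₂ q≡d) ab₂)

  internallyDisjointʷ : ∀ {a b c d} (p : Walk a b) (q : Walk c d) (up : IsPath p) (uq : IsPath q) →
    (∀ {y} → y ∈ vertices p → y ∈ vertices q → Endpoint a b y × Endpoint c d y) →
    2 ≤ length q ⊎ (∃ λ z → Endpoint c d z × ¬ Endpoint a b z) →
    InternallyDisjoint (toPath p up) (toPath q uq)
  internallyDisjointʷ p q up uq common =
    internallyDisjoint (toPath p up) (toPath q uq) λ i j eq →
      let ab , cd = common (vertexAt∈vertices p i) (subst (_∈ vertices q) (sym eq) (vertexAt∈vertices q j))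
      in ab , subst (Endpoint _ _) eq cd

module OddCycles (G : Graph) where
  open Walks G
  open import Data.List.Membership.DecPropositional (_≟_ {n G}) using (_∈?_)

  record OddCycle : Set where
    field
      base       : V G
      closedWalk : Walk base base
      isCycle    : IsCycle closedWalk
      isOdd      : parity (length closedWalk) ≡ 1ℙ

  open OddCycle public

  infix 4 _∈ᶜ_
  _∈ᶜ_ : V G → OddCycle → Set
  y ∈ᶜ O = y ∈ initVertices (closedWalk O)

  _∈ᶜ?_ : ∀ y O → Dec (y ∈ᶜ O)
  y ∈ᶜ? O = y ∈? initVertices (closedWalk O)

  base∈ᶜ : ∀ O → base O ∈ᶜ O
  base∈ᶜ O = nonempty (closedWalk O) (isOdd O)
    where
    nonempty : ∀ {z} (Z : Walk z z) → parity (length Z) ≡ 1ℙ → z ∈ initVertices Z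
    nonempty (cons _ _ _) _ = here refl

  Joins⇒≢ : ∀ {e x y} → Joins G e x y → x ≢ y
  Joins⇒≢ {e} (inj₁ p) x≡y = loopless G e (trans (cong proj₁ p) (trans x≡y (sym (cong proj₂ p))))
  Joins⇒≢ {e} (inj₂ p) x≡y = loopless G e (trans (cong proj₁ p) (trans (sym x≡y) (sym (cong proj₂ p))))

  ∃-other∈ᶜ : ∀ O c → ∃ λ y → y ∈ᶜ O × y ≢ c
  ∃-other∈ᶜ O c = firstTwo (closedWalk O) (isOdd O)
    where
    firstTwo : ∀ {z} (Z : Walk z z) → parity (length Z) ≡ 1ℙ → ∃ λ y → y ∈ initVertices Z × y ≢ c
    firstTwo (cons {z} {v} e j Z′) _ with z ≟ c
    ... | no  z≢c  = z , here refl , z≢c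
    ... | yes refl = v , there (start∈initVertices Z′ v≢z) , v≢z
      where
      v≢z : v ≢ z
      v≢z v≡z = Joins⇒≢ j (sym v≡z)

  AtMostOneShared : OddCycle → OddCycle → Set
  AtMostOneShared C D = ∀ {y y′} → y ∈ᶜ C → y ∈ᶜ D → y′ ∈ᶜ C → y′ ∈ᶜ D → y ≡ y′

  record Arc (O : OddCycle) (x y : V G) : Set where
    field
      path    : Walk x y
      isPath  : IsPath path
      onCycle : ∀ {v} → v ∈ vertices path → v ∈ᶜ O

  open Arc public

  arcs : ∀ O {x y} → x ∈ᶜ O → y ∈ᶜ O → x ≢ y →
         Σ (Arc O x y) λ A₁ → Σ (Arc O x y) λ A₂ → MeetWithin (path A₁) (path A₂) x y ×
           parity (length (path A₁)) ⊕ parity (length (path A₂)) ≡ 1ℙ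
  arcs O {x} {y} x∈ y∈ x≢y with rotate (closedWalk O) (isCycle O) x∈
  ... | record { rotated = R ; isCycle = R-cycle ; ⊆original = ⊆O ; ⊇original = ⊇O ; length≡ = R-length }
    with split R (initVertices⊆vertices R (⊇O y∈))
  ... | Q₁ , Q₂ , refl with IsCycle-++ʷ⁻ Q₁ Q₂ x≢y R-cycle
  ... | Q₁-path , Q₂-path , meet =
    record { path = Q₁ ; isPath = Q₁-path ; onCycle = λ v∈ → onR (∈-++ʷ⁺ˡ Q₁ Q₂ v∈) } ,
    record { path = reverse Q₂ ; isPath = IsPath-reverse Q₂ Q₂-path
           ; onCycle = λ v∈ → onR (∈-++ʷ⁺ʳ Q₁ Q₂ (∈-reverse⁻ Q₂ v∈)) } ,
    (λ v∈Q₁ v∈Q₂ → meet v∈Q₁ (∈-reverse⁻ Q₂ v∈Q₂)) ,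
    parity-sum
    where
    onR : ∀ {v} → v ∈ vertices (Q₁ ++ʷ Q₂) → v ∈ᶜ O
    onR v∈ with ∈vertices⇒∈initVertices⊎end (Q₁ ++ʷ Q₂) v∈
    ... | inj₁ v∈′ = ⊆O v∈′
    ... | inj₂ refl = x∈
    parity-sum : parity (length Q₁) ⊕ parity (length (reverse Q₂)) ≡ 1ℙ
    parity-sum = begin
      parity (length Q₁) ⊕ parity (length (reverse Q₂)) ≡⟨ cong (λ l → parity (length Q₁) ⊕ parity l)
                                                                (length-reverse Q₂) ⟩
      parity (length Q₁) ⊕ parity (length Q₂)           ≡⟨ sym (+-homo-+ (length Q₁) (length Q₂)) ⟩
      parity (length Q₁ + length Q₂)                    ≡⟨ cong parity (sym (length-++ʷ Q₁ Q₂)) ⟩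
      parity (length (Q₁ ++ʷ Q₂))                       ≡⟨ cong parity R-length ⟩
      parity (length (closedWalk O))                    ≡⟨ isOdd O ⟩
      1ℙ                                                ∎
      where open ≡-Reasoning

  arc-ofParity : ∀ O {x y} → x ∈ᶜ O → y ∈ᶜ O → x ≢ y → ∀ r →
                 Σ (Arc O x y) λ A → parity (length (path A)) ⊕ r ≡ 1ℙ
  arc-ofParity O x∈ y∈ x≢y r with arcs O x∈ y∈ x≢y
  ... | A₁ , A₂ , _ , opposite
    with opposite-parities (parity (length (path A₁))) (parity (length (path A₂))) r opposite
  ... | inj₁ (A₁-odd , _) = A₁ , A₁-odd
  ... | inj₂ (A₂-odd , _) = A₂ , A₂-odd

  oddEvenArcs : ∀ O {x y} → x ∈ᶜ O → y ∈ᶜ O → x ≢ y →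
                Σ (Arc O x y) λ A₁ → Σ (Arc O x y) λ A₂ → MeetWithin (path A₁) (path A₂) x y ×
                  parity (length (path A₁)) ≡ 1ℙ × parity (length (path A₂)) ≡ 0ℙ
  oddEvenArcs O x∈ y∈ x≢y with arcs O x∈ y∈ x≢y
  ... | A₁ , A₂ , meet , opposite
    with opposite-parities (parity (length (path A₁))) (parity (length (path A₂))) 0ℙ opposite
  ... | inj₁ (odd , even) = A₁ , A₂ , meet , trans (sym (⊕-identityʳ _)) odd , trans (sym (⊕-identityʳ _)) even
  ... | inj₂ (odd , even) = A₂ , A₁ , (λ v∈₂ v∈₁ → meet v∈₁ v∈₂) ,
                            trans (sym (⊕-identityʳ _)) odd , trans (sym (⊕-identityʳ _)) even

  fromCircuit : (C : Circuit G) → OddCircuit C → Σ OddCycle λ O → ∀ {y} → y ∈ᶜ O → ∃ λ i → cvert C i ≡ y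
  fromCircuit C C-odd =
    O , λ y∈ → ∈-sequenceWalk (k C) (cvert C) _ (cjoins C) (subst (_ ∈_) initVertices≡ y∈)
    where
    open WalksAsPaths G
    around : Walk (cvert C zero) (cvert C (fromℕ (k C)))
    around = sequenceWalk (k C) (cvert C) (λ i → cedge C (inject₁ i)) (cjoins C)
    closing : Walk (cvert C (fromℕ (k C))) (cvert C zero)
    closing = cons (cedge C (fromℕ (k C))) (cjoinsLast C) (nil (cvert C zero))
    initVertices≡ : initVertices (around ++ʷ closing) ≡ vertices around
    initVertices≡ = trans (initVertices-++ʷ around closing) (sym (vertices≡initVertices∷ʳ around))
    length≡ : length (around ++ʷ closing) ≡ clen C
    length≡ = trans (length-++ʷ around closing)
                (trans (cong (_+ 1) (length-sequenceWalk (k C) _ _ _)) (+-comm (k C) 1))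
    O : OddCycle
    O = record
      { base       = cvert C zero
      ; closedWalk = around ++ʷ closing
      ; isCycle    = subst Unique (sym initVertices≡) (IsPath-sequenceWalk (k C) (cvert C) _ (cjoins C) (cvinj C))
      ; isOdd      = trans (cong parity length≡) (Odd⇒parity C-odd)
      }

module Theta (G : Graph) where
  open Walks G
  open WalksAsPaths G

  -- The odd-C₃⁺ arises by splitting the even path after its first edge ac.
  oddC3+-fromTheta : ∀ {a b} → a ≢ b → (X Y Z : Walk a b) → IsPath X → IsPath Y → IsPath Z →
    MeetWithin X Y a b → MeetWithin X Z a b → MeetWithin Y Z a b →
    parity (length X) ≡ 1ℙ → parity (length Y) ≡ 1ℙ → parity (length Z) ≡ 0ℙ → 2 ≤ length Y →
    OddC3+ G
  oddC3+-fromTheta a≢a _ _ (nil _) _ _ _ _ _ _ _ _ _ _ = ⊥-elim (a≢a refl)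
  oddC3+-fromTheta {a} {b} a≢b X Y Z@(cons {_} {c} e j Z′) X-path Y-path (a≢Z′ ∷ Z′-path)
                   meetXY meetXZ meetYZ X-odd Y-odd Z-even 2≤Y = record
    { a = a ; b = b ; c = c
    ; a≢b = a≢b ; b≢c = λ b≡c → c≢b (sym b≡c) ; c≢a = c≢a
    ; P₁ = toPath X X-path ; P₂ = toPath Y Y-path
    ; P₃ = toPath (reverse Z′) (IsPath-reverse Z′ Z′-path) ; P₄ = toPath ca ca-path
    ; odd₁ = parity⇒Odd _ X-odd ; odd₂ = parity⇒Odd _ Y-odd
    ; odd₃ = parity⇒Odd _ (trans (cong parity (length-reverse Z′)) Z′-odd) ; odd₄ = 0 , refl
    ; d₁₂ = internallyDisjointʷ X Y X-path Y-path (λ y∈X y∈Y → meetXY y∈X y∈Y , meetXY y∈X y∈Y) (inj₁ 2≤Y)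
    ; d₁₃ = disjoint-bc X X-path meetXZ ; d₁₄ = disjoint-ca X X-path meetXZ
    ; d₂₃ = disjoint-bc Y Y-path meetYZ ; d₂₄ = disjoint-ca Y Y-path meetYZ
    ; d₃₄ = internallyDisjointʷ (reverse Z′) ca (IsPath-reverse Z′ Z′-path) ca-path
              (λ { _ (here refl) → inj₂ refl , inj₁ refl
                 ; y∈ (there (here refl)) → ⊥-elim (a∉Z′ (∈-reverse⁻ Z′ y∈)) })
              (inj₂ (a , inj₂ refl , [ a≢b , (λ a≡c → c≢a (sym a≡c)) ]′))
    }
    where
    a∉Z′ : a ∉ vertices Z′
    a∉Z′ = All¬⇒¬Any a≢Z′
    Z′-odd : parity (length Z′) ≡ 1ℙ
    Z′-odd = trans (sym (suc-homo-⁻¹ (length Z′))) (cong _⁻¹ Z-even)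
    c≢a : c ≢ a
    c≢a c≡a = a∉Z′ (subst (_∈ vertices Z′) c≡a (start∈vertices Z′))
    c≢b : c ≢ b
    c≢b = IsPath⇒start≢end Z′ Z′-path (parity≡1ℙ⇒≥1 Z′-odd)
    c∉ab : ¬ Endpoint a b c
    c∉ab = [ c≢a , c≢b ]′
    ca : Walk c a
    ca = cons e (Joins-sym j) (nil a)
    ca-path : IsPath ca
    ca-path = (c≢a ∷ []) ∷ [] ∷ []
    disjoint-bc : (W : Walk a b) (W-path : IsPath W) → MeetWithin W Z a b →
                  InternallyDisjoint (toPath W W-path) (toPath (reverse Z′) (IsPath-reverse Z′ Z′-path))
    disjoint-bc W W-path meet =
      internallyDisjointʷ W (reverse Z′) W-path (IsPath-reverse Z′ Z′-path) common (inj₂ (c , inj₂ refl , c∉ab))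
      where
      common : ∀ {y} → y ∈ vertices W → y ∈ vertices (reverse Z′) → Endpoint a b y × Endpoint b c y
      common y∈W y∈Z′ with meet y∈W (there (∈-reverse⁻ Z′ y∈Z′))
      ... | inj₁ refl = ⊥-elim (a∉Z′ (∈-reverse⁻ Z′ y∈Z′))
      ... | inj₂ refl = inj₂ refl , inj₁ refl
    disjoint-ca : (W : Walk a b) (W-path : IsPath W) → MeetWithin W Z a b →
                  InternallyDisjoint (toPath W W-path) (toPath ca ca-path)
    disjoint-ca W W-path meet = internallyDisjointʷ W ca W-path ca-path common (inj₂ (c , inj₁ refl , c∉ab))
      where
      common : ∀ {y} → y ∈ vertices W → y ∈ vertices ca → Endpoint a b y × Endpoint c a y
      common y∈W (here refl)         = ⊥-elim (c∉ab (meet y∈W (there (start∈vertices Z′))))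
      common y∈W (there (here refl)) = inj₁ refl , inj₂ refl

module Bridges (G : Graph) (no-cut-vertex : ∀ v → ConnectedAvoiding G v) where
  open Walks G
  open WalksAsPaths G
  open OddCycles G
  open Theta G
  open import Data.List.Membership.DecPropositional (_≟_ {n G}) using (_∈?_)

  record Bridge (C D : OddCycle) {c d : V G} (P : Walk c d) : Set where
    field
      simple : IsPath P
      c∈C    : c ∈ᶜ C
      d∈D    : d ∈ᶜ D
      meetsC : ∀ {y} → y ∈ vertices P → y ∈ᶜ C → y ≡ c
      meetsD : ∀ {y} → y ∈ vertices P → y ∈ᶜ D → y ≡ d
      C∩D    : ∀ {y} → y ∈ᶜ C → y ∈ᶜ D → y ≡ c × y ≡ d

  record Detour (C D : OddCycle) {c₁ d₁ : V G} (P : Walk c₁ d₁) : Set where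
    field
      c₂ x       : V G
      Q          : Walk c₂ x
      Q-path     : IsPath Q
      c₂∈C       : c₂ ∈ᶜ C
      x∈D⊎P      : x ∈ᶜ D ⊎ x ∈ vertices P
      Q-avoids   : ∀ {y} → y ∈ vertices Q → y ≢ c₁
      Q-meetsC   : ∀ {y} → y ∈ vertices Q → y ∈ᶜ C → y ≡ c₂
      Q-meetsD⊎P : ∀ {y} → y ∈ vertices Q → y ∈ᶜ D ⊎ y ∈ vertices P → y ≡ x

  detour : ∀ {C D c₁ d₁} {P : Walk c₁ d₁} → Bridge C D P → Detour C D P
  detour {C} {D} {c₁} {P = P} _ = avoiding-c₁
    where
    T : V G → Set
    T y = (y ∈ᶜ D ⊎ y ∈ vertices P) × y ≢ c₁
    T? : ∀ y → Dec (T y)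
    T? y = ((y ∈ᶜ? D) ⊎-dec (y ∈? vertices P)) ×-dec ¬? (y ≟ c₁)
    avoiding-c₁ : Detour C D P
    avoiding-c₁ with ∃-other∈ᶜ C c₁ | ∃-other∈ᶜ D c₁
    ... | c′ , c′∈C , c′≢c₁ | d′ , d′∈D , d′≢c₁ with no-cut-vertex c₁ c′ d′ c′≢c₁ d′≢c₁
    ... | P₀ , P₀-avoids with fromPath P₀
    ... | W₀ , W₀-path , W₀⊆P₀ with stPath (_∈ᶜ? C) T? W₀ W₀-path c′∈C (inj₁ d′∈D , d′≢c₁)
    ... | record { from = c₂ ; to = x ; segment = Q ; isPath = Q-path ; from∈S = c₂∈C ; to∈T = (x∈D⊎P , _)
                 ; ⊆p = Q⊆W₀ ; meetsS = meetsS ; meetsT = meetsT } = record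
      { c₂ = c₂ ; x = x ; Q = Q ; Q-path = Q-path ; c₂∈C = c₂∈C ; x∈D⊎P = x∈D⊎P
      ; Q-avoids = Q-avoids ; Q-meetsC = meetsS
      ; Q-meetsD⊎P = λ y∈Q y∈D⊎P → meetsT y∈Q (y∈D⊎P , Q-avoids y∈Q) }
      where
      Q-avoids : ∀ {y} → y ∈ vertices Q → y ≢ c₁
      Q-avoids y∈Q y≡c₁ with W₀⊆P₀ (Q⊆W₀ y∈Q)
      ... | i , vi≡y = P₀-avoids i (trans vi≡y y≡c₁)

  module _ {C D : OddCycle} {c₁ d₁ : V G} {P : Walk c₁ d₁} (b : Bridge C D P) (δ : Detour C D P) where
    open Bridge b
    open Detour δ

    c₂≢c₁ : c₂ ≢ c₁
    c₂≢c₁ = Q-avoids (start∈vertices Q)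

    c₁≢c₂ : c₁ ≢ c₂
    c₁≢c₂ c₁≡c₂ = c₂≢c₁ (sym c₁≡c₂)

    c₁≢x : c₁ ≢ x
    c₁≢x c₁≡x = Q-avoids (end∈vertices Q) (sym c₁≡x)

    c₂≢x : c₂ ≢ x
    c₂≢x refl with x∈D⊎P
    ... | inj₁ c₂∈D = c₂≢c₁ (proj₁ (C∩D c₂∈C c₂∈D))
    ... | inj₂ c₂∈P = c₂≢c₁ (meetsC c₂∈P c₂∈C)

    d₁≢x : x ∉ vertices P → d₁ ≢ x
    d₁≢x x∉P refl = x∉P (end∈vertices P)

    oddPath-viaD : x ∉ vertices P → x ∈ᶜ D →
      Σ (Walk c₁ c₂) λ R → IsPath R × (∀ {y} → y ∈ vertices R → y ∈ᶜ C → Endpoint c₁ c₂ y) ×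
        parity (length R) ≡ 1ℙ × 2 ≤ length R
    oddPath-viaD x∉P x∈D with arc-ofParity D d∈D x∈D (d₁≢x x∉P) (parity (length P + length Q))
    ... | B , B-parity = P ++ʷ BQ , IsPath-++ʷ P BQ simple BQ-path P∩BQ , R-meetsC , R-odd , 2≤R
      where
      BQ : Walk d₁ c₂
      BQ = path B ++ʷ reverse Q
      BQ-path : IsPath BQ
      BQ-path = IsPath-++ʷ (path B) (reverse Q) (isPath B) (IsPath-reverse Q Q-path)
        λ y∈B y∈Q → Q-meetsD⊎P (∈-reverse⁻ Q y∈Q) (inj₁ (onCycle B y∈B))
      P∩BQ : ∀ {y} → y ∈ vertices P → y ∈ vertices BQ → y ≡ d₁
      P∩BQ y∈P y∈BQ with ∈-++ʷ⁻ (path B) (reverse Q) y∈BQ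
      ... | inj₁ y∈B = meetsD y∈P (onCycle B y∈B)
      ... | inj₂ y∈Q =
        ⊥-elim (x∉P (subst (_∈ vertices P) (Q-meetsD⊎P (∈-reverse⁻ Q y∈Q) (inj₂ y∈P)) y∈P))
      R-meetsC : ∀ {y} → y ∈ vertices (P ++ʷ BQ) → y ∈ᶜ C → Endpoint c₁ c₂ y
      R-meetsC y∈R y∈C with ∈-++ʷ⁻ P BQ y∈R
      ... | inj₁ y∈P = inj₁ (meetsC y∈P y∈C)
      ... | inj₂ y∈BQ with ∈-++ʷ⁻ (path B) (reverse Q) y∈BQ
      ... | inj₁ y∈B = inj₁ (proj₁ (C∩D y∈C (onCycle B y∈B)))
      ... | inj₂ y∈Q = inj₂ (Q-meetsC (∈-reverse⁻ Q y∈Q) y∈C)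
      R-length : length (P ++ʷ BQ) ≡ length P + length (path B) + length Q
      R-length = begin
        length (P ++ʷ BQ)                                   ≡⟨ length-++ʷ P BQ ⟩
        length P + length BQ                                ≡⟨ cong (length P +_) (length-++ʷ (path B) (reverse Q)) ⟩
        length P + (length (path B) + length (reverse Q))   ≡⟨ cong (λ l → length P + (length (path B) + l))
                                                                    (length-reverse Q) ⟩
        length P + (length (path B) + length Q)             ≡⟨ sym (+-assoc (length P) _ _) ⟩
        length P + length (path B) + length Q               ∎
        where open ≡-Reasoning
      R-odd : parity (length (P ++ʷ BQ)) ≡ 1ℙ
      R-odd = trans (cong parity R-length) (trans (parity-rearrange (length P) _ (length Q)) B-parity)
      2≤R : 2 ≤ length (P ++ʷ BQ)
      2≤R = subst (2 ≤_) (sym R-length)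
        (≤-trans (+-mono-≤ (length≥1 (path B) (d₁≢x x∉P)) (length≥1 Q c₂≢x))
                 (+-monoˡ-≤ (length Q) (m≤n+m (length (path B)) (length P))))

    detour-toD : x ∉ vertices P → OddC3+ G
    detour-toD x∉P with x∈D⊎P
    ... | inj₂ x∈P = ⊥-elim (x∉P x∈P)
    ... | inj₁ x∈D with oddPath-viaD x∉P x∈D | oddEvenArcs C c∈C c₂∈C c₁≢c₂
    ... | R , R-path , R-meetsC , R-odd , 2≤R | X , Z , X∩Z , X-odd , Z-even =
      oddC3+-fromTheta c₁≢c₂ (path X) R (path Z) (isPath X) R-path (isPath Z)
        (λ y∈X y∈R → R-meetsC y∈R (onCycle X y∈X)) X∩Z (λ y∈R y∈Z → R-meetsC y∈R (onCycle Z y∈Z))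
        X-odd R-odd Z-even 2≤R

    module _ {P₁ : Walk c₁ x} {P₂ : Walk x d₁} (P≡P₁P₂ : P ≡ P₁ ++ʷ P₂) where

      ∈P₁⇒∈P : ∀ {y} → y ∈ vertices P₁ → y ∈ vertices P
      ∈P₁⇒∈P y∈ = subst (λ W → _ ∈ vertices W) (sym P≡P₁P₂) (∈-++ʷ⁺ˡ P₁ P₂ y∈)

      ∈P₂⇒∈P : ∀ {y} → y ∈ vertices P₂ → y ∈ vertices P
      ∈P₂⇒∈P y∈ = subst (λ W → _ ∈ vertices W) (sym P≡P₁P₂) (∈-++ʷ⁺ʳ P₁ P₂ y∈)

      P₁P₂-split : IsPath P₁ × IsPath P₂ × (∀ {y} → y ∈ vertices P₁ → y ∈ vertices P₂ → y ≡ x)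
      P₁P₂-split = IsPath-++ʷ⁻ P₁ P₂ (subst IsPath P≡P₁P₂ simple)

      P₁∩P₂ : ∀ {y} → y ∈ vertices P₁ → y ∈ vertices P₂ → y ≡ x
      P₁∩P₂ = proj₂ (proj₂ P₁P₂-split)

      oddCycle-viaP : Σ OddCycle λ C′ → base C′ ≡ x ×
                        (∀ {y} → y ∈ᶜ C′ → y ∈ vertices Q ⊎ y ∈ᶜ C ⊎ y ∈ vertices P₁)
      oddCycle-viaP with arc-ofParity C c₂∈C c∈C c₂≢c₁ (parity (length Q + length P₁))
      ... | A , A-parity = C′ , refl , ∈C′
        where
        QA : Walk x c₁
        QA = reverse Q ++ʷ path A
        QA-path : IsPath QA
        QA-path = IsPath-++ʷ (reverse Q) (path A) (IsPath-reverse Q Q-path) (isPath A)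
          λ y∈Q y∈A → Q-meetsC (∈-reverse⁻ Q y∈Q) (onCycle A y∈A)
        QA∩P₁ : MeetWithin QA P₁ x c₁
        QA∩P₁ y∈QA y∈P₁ with ∈-++ʷ⁻ (reverse Q) (path A) y∈QA
        ... | inj₁ y∈Q = inj₁ (Q-meetsD⊎P (∈-reverse⁻ Q y∈Q) (inj₂ (∈P₁⇒∈P y∈P₁)))
        ... | inj₂ y∈A = inj₂ (meetsC (∈P₁⇒∈P y∈P₁) (onCycle A y∈A))
        C′-length : length (QA ++ʷ P₁) ≡ length Q + length (path A) + length P₁
        C′-length = begin
          length (QA ++ʷ P₁)                                ≡⟨ length-++ʷ QA P₁ ⟩
          length QA + length P₁                             ≡⟨ cong (_+ length P₁) (length-++ʷ (reverse Q) (path A)) ⟩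
          length (reverse Q) + length (path A) + length P₁  ≡⟨ cong (λ l → l + length (path A) + length P₁)
                                                                  (length-reverse Q) ⟩
          length Q + length (path A) + length P₁            ∎
          where open ≡-Reasoning
        C′ : OddCycle
        C′ = record
          { base       = x
          ; closedWalk = QA ++ʷ P₁
          ; isCycle    = IsCycle-++ʷ QA P₁ QA-path (proj₁ P₁P₂-split) QA∩P₁
          ; isOdd      = trans (cong parity C′-length)
                               (trans (parity-rearrange (length Q) _ (length P₁)) A-parity)
          }
        ∈C′ : ∀ {y} → y ∈ᶜ C′ → y ∈ vertices Q ⊎ y ∈ᶜ C ⊎ y ∈ vertices P₁
        ∈C′ y∈ with ∈-++ʷ⁻ QA P₁ (initVertices⊆vertices (QA ++ʷ P₁) y∈)
        ... | inj₂ y∈P₁ = inj₂ (inj₂ y∈P₁)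
        ... | inj₁ y∈QA with ∈-++ʷ⁻ (reverse Q) (path A) y∈QA
        ... | inj₁ y∈Q = inj₁ (∈-reverse⁻ Q y∈Q)
        ... | inj₂ y∈A = inj₂ (inj₁ (onCycle A y∈A))

      bridge-viaP : x ∈ vertices P → Σ OddCycle λ C′ → Bridge C′ D P₂
      bridge-viaP x∈P with oddCycle-viaP
      ... | C′ , refl , ∈C′ = C′ , record
        { simple = proj₁ (proj₂ P₁P₂-split)
        ; c∈C    = base∈ᶜ C′
        ; d∈D    = d∈D
        ; meetsC = meetsC′
        ; meetsD = λ y∈P₂ y∈D → meetsD (∈P₂⇒∈P y∈P₂) y∈D
        ; C∩D    = C′∩D
        }
        where
        meetsC′ : ∀ {y} → y ∈ vertices P₂ → y ∈ᶜ C′ → y ≡ x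
        meetsC′ y∈P₂ y∈C′ with ∈C′ y∈C′
        ... | inj₁ y∈Q         = Q-meetsD⊎P y∈Q (inj₂ (∈P₂⇒∈P y∈P₂))
        ... | inj₂ (inj₂ y∈P₁) = P₁∩P₂ y∈P₁ y∈P₂
        ... | inj₂ (inj₁ y∈C) with meetsC (∈P₂⇒∈P y∈P₂) y∈C
        ...   | refl = P₁∩P₂ (start∈vertices P₁) y∈P₂
        C′∩D : ∀ {y} → y ∈ᶜ C′ → y ∈ᶜ D → y ≡ x × y ≡ d₁
        C′∩D y∈C′ y∈D with ∈C′ y∈C′
        ... | inj₁ y∈Q with Q-meetsD⊎P y∈Q (inj₁ y∈D)
        ...   | refl = refl , meetsD x∈P y∈D
        C′∩D y∈C′ y∈D | inj₂ (inj₁ y∈C) with C∩D y∈C y∈D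
        ...   | refl , c₁≡d₁ =
          P₁∩P₂ (start∈vertices P₁) (subst (_∈ vertices P₂) (sym c₁≡d₁) (end∈vertices P₂)) , c₁≡d₁
        C′∩D y∈C′ y∈D | inj₂ (inj₂ y∈P₁) with meetsD (∈P₁⇒∈P y∈P₁) y∈D
        ...   | refl = P₁∩P₂ y∈P₁ (end∈vertices P₂) , refl

    detour-toP : x ∈ vertices P →
                 Σ OddCycle λ C′ → Σ (Walk x d₁) λ P′ → Bridge C′ D P′ × length P′ < length P
    detour-toP x∈P with split P x∈P
    ... | P₁ , P₂ , P≡P₁P₂ with bridge-viaP P≡P₁P₂ x∈P
    ... | C′ , b′ = C′ , P₂ , b′ , shorter
      where
      shorter : length P₂ < length P
      shorter = subst (length P₂ <_) (sym (trans (cong length P≡P₁P₂) (length-++ʷ P₁ P₂)))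
        (+-monoˡ-≤ (length P₂) {1} {length P₁} (length≥1 P₁ c₁≢x))

  fromBridge : ∀ {D} C {c d} (P : Walk c d) → Bridge C D P → OddC3+ G
  fromBridge {D} C P b = <-rec Goal step (length P) C P b refl
    where
    Goal : ℕ → Set
    Goal l = ∀ C {c d} (P : Walk c d) → Bridge C D P → length P ≡ l → OddC3+ G
    step : ∀ l → (∀ {l′} → l′ < l → Goal l′) → Goal l
    step _ shorter-bridge C P b refl with detour b
    ... | δ with Detour.x δ ∈? vertices P
    ...   | no  x∉P = detour-toD b δ x∉P
    ...   | yes x∈P with detour-toP b δ x∈P
    ...     | C′ , P′ , b′ , P′<P = shorter-bridge P′<P C′ P′ b′ refl

  initialBridge : Connected G → ∀ C D → AtMostOneShared C D →
                  Σ (V G) λ c → Σ (V G) λ d → Σ (Walk c d) λ P → Bridge C D P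
  initialBridge connected C D ≤1-common with any? (_∈ᶜ? D) (initVertices (closedWalk C))
  ... | yes C∩D≢∅ with find C∩D≢∅
  ... | v , v∈C , v∈D = v , v , nil v , record
    { simple = [] ∷ [] ; c∈C = v∈C ; d∈D = v∈D
    ; meetsC = λ { (here y≡v) _ → y≡v } ; meetsD = λ { (here y≡v) _ → y≡v }
    ; C∩D    = λ y∈C y∈D → ≤1-common y∈C y∈D v∈C v∈D , ≤1-common y∈C y∈D v∈C v∈D }
  initialBridge connected C D _ | no C∩D≡∅ with fromPath (connected (base C) (base D))
  ... | W , W-path , _ with stPath (_∈ᶜ? C) (_∈ᶜ? D) W W-path (base∈ᶜ C) (base∈ᶜ D)
  ... | record { from = c ; to = d ; segment = P ; isPath = P-path ; from∈S = c∈C ; to∈T = d∈D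
               ; meetsS = meetsC ; meetsT = meetsD } =
    c , d , P , record
      { simple = P-path ; c∈C = c∈C ; d∈D = d∈D ; meetsC = meetsC ; meetsD = meetsD
      ; C∩D = λ y∈C y∈D → ⊥-elim (C∩D≡∅ (lose y∈C y∈D)) }

  oddC3+-fromOddCycles : Connected G → ∀ C D → AtMostOneShared C D → OddC3+ G
  oddC3+-fromOddCycles connected C D ≤1-common with initialBridge connected C D ≤1-common
  ... | _ , _ , P , b = fromBridge C P b

propositionA6 : (G : Graph) → TwoConnected G →
    (C D : Circuit G) → OddCircuit C → OddCircuit D →
    AtMostOneCommonVertex C D → OddC3+ G
propositionA6 G (_ , connected , no-cut-vertex) C D C-odd D-odd ≤1-common
  with OddCycles.fromCircuit G C C-odd | OddCycles.fromCircuit G D D-odd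
... | C° , C°⊆C | D° , D°⊆D = oddC3+-fromOddCycles connected C° D° ≤1-common°
  where
  open OddCycles G
  open Bridges G no-cut-vertex
  ≤1-common° : AtMostOneShared C° D°
  ≤1-common° y∈C y∈D y′∈C y′∈D with C°⊆C y∈C | D°⊆D y∈D | C°⊆C y′∈C | D°⊆D y′∈D
  ... | i , refl | j , Dj≡Ci | i′ , refl | j′ , Dj′≡Ci′ = ≤1-common i j i′ j′ (sym Dj≡Ci) (sym Dj′≡Ci′)
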